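{- For every integer $c\ge 1$, the graph $D_c$ admits a good $c$-edge-labeling, where $D_c$ has vertex set $\{v,v_1,\dots,v_c\}\cup\{v_{i,j} : 1\le i<j\le c\}$ and edge set $\{vv_i : i\in[c]\}\cup\{v_iv_{i,j},\ v_jv_{i,j} : 1\le i<j\le c\}$.
   Context: An edge-labeling of a graph $G$ is a function $\lambda:E(G)\to\mathbb{R}$; it is a $c$-edge-labeling if it takes at most $c$ distinct values. A path is increasing if the sequence of labels of its edges, read along the path, is non-decreasing. An edge-labeling is good if for every ordered pair of vertices $(x,y)$ there are no two distinct increasing paths from $x$ to $y$. -}

module Defs where

open import Data.Nat using (ℕ; suc; _≤_)
open import Data.Fin using (Fin) renaming (_<_ to _<ᶠ_)
open import Data.Product using (_×_; _,_; ∃; ∃-syntax)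
open import Data.Sum using (_⊎_)
open import Data.List using (List; []; _∷_; length)
open import Data.List.Membership.Propositional using (_∈_)
open import Data.List.Relation.Unary.Unique.Propositional using (Unique)
open import Data.List.Relation.Unary.Linked using (Linked)
open import Relation.Binary.PropositionalEquality using (_≡_; _≢_)
open import Relation.Nullary using (¬_)

-- The graph D_c
-- vertices: v (hub), v_i (leaf i), v_{i,j} (mid i j, with i < j)

data Vertex (c : ℕ) : Set where
  hub  : Vertex c
  leaf : Fin c → Vertex c
  mid  : (i j : Fin c) → i <ᶠ j → Vertex c

data Edge (c : ℕ) : Set where
  spoke : Fin c → Edge c
  left  : (i j : Fin c) → i <ᶠ j → Edge c
  right : (i j : Fin c) → i <ᶠ j → Edge c

ends : ∀ {c} → Edge c → Vertex c × Vertex c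
ends (spoke i)       = hub , leaf i
ends (left i j p)    = leaf i , mid i j p
ends (right i j p)   = leaf j , mid i j p

Joins : ∀ {c} → Edge c → Vertex c → Vertex c → Set
Joins e x y = (ends e ≡ (x , y)) ⊎ (ends e ≡ (y , x))

data Walk {c : ℕ} : Vertex c → Vertex c → Set where
  []   : ∀ {x} → Walk x x
  step : ∀ {x y z} (e : Edge c) → Joins e x y → Walk y z → Walk x z

vertices : ∀ {c} {x y : Vertex c} → Walk x y → List (Vertex c)
vertices {x = x} []         = x ∷ []
vertices {x = x} (step e _ w) = x ∷ vertices w

edges : ∀ {c} {x y : Vertex c} → Walk x y → List (Edge c)
edges []           = []
edges (step e _ w) = e ∷ edges w

IsPath : ∀ {c} {x y : Vertex c} → Walk x y → Set
IsPath w = Unique (vertices w)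

Labeling : ℕ → Set
Labeling c = Edge c → ℕ

labels : ∀ {c} {x y : Vertex c} → Labeling c → Walk x y → List ℕ
labels λ' w = Data.List.map λ' (edges w)

Increasing : ∀ {c} {x y : Vertex c} → Labeling c → Walk x y → Set
Increasing λ' w = Linked _≤_ (labels λ' w)

IsKLabeling : ∀ {c} → ℕ → Labeling c → Set
IsKLabeling k λ' = ∃[ L ] (length L ≤ k × (∀ e → λ' e ∈ L))

Good : ∀ {c} → Labeling c → Set
Good {c} λ' = (x y : Vertex c) (p q : Walk x y) →
  ¬ (IsPath p × IsPath q × Increasing λ' p × Increasing λ' q × vertices p ≢ vertices q)

{-# OPTIONS --safe #-}
-- Send hub ↦ ∅, v_k ↦ {k} and v_{i,j} ↦ {i,j}: this embeds D_c in the hypercube on the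
-- subsets of ℕ, and with label(v_k v_{i,j}) the other element of {i,j} and label(v v_k) = k
-- every edge with label ℓ joins S to S △ {ℓ}. Increasing paths never use one label
-- twice in a row (the labeling is proper), so they are strictly increasing and toggle
-- every coordinate at most once. A strictly increasing walk from S to T therefore toggles
-- exactly the coordinates of S △ T, in increasing order: its first label is min (S △ T),
-- and properness makes that first step, hence by induction the whole walk, unique.
module Submission where

open import Defs
open import Data.Bool using (Bool; true; false; not; _xor_)
open import Data.Bool.Properties using (xor-same; xor-comm; xor-assoc; xor-identityʳ; true-xor; not-¬)
open import Data.Nat using (ℕ; _≥_; _<_)
open import Data.Nat.Properties
  using (_≟_; <⇒≢; >⇒≢; <-trans; ≤-antisym; ≮⇒≥; ≤∧≢⇒<; ≤-reflexive)
open import Data.Fin using (Fin; toℕ)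
open import Data.Fin.Properties using (toℕ-injective; toℕ<n; <-irrelevant)
open import Data.Product using (_×_; _,_; ∃-syntax)
open import Data.Sum using (inj₁; inj₂; swap)
open import Data.List using (_∷_; upTo)
open import Data.List.Properties using (length-upTo)
open import Data.List.Membership.Propositional using (_∈_)
open import Data.List.Membership.Propositional.Properties using (∈-upTo⁺)
open import Data.List.Relation.Unary.Any using (here; there)
open import Data.List.Relation.Unary.All as All using (All; []; _∷_)
open import Data.List.Relation.Unary.AllPairs as AllPairs using (_∷_)
open import Data.List.Relation.Unary.Linked as Linked using (Linked; []; [-]; _∷_)
open import Data.List.Relation.Unary.Linked.Properties using (Linked⇒All; Linked⇒AllPairs)
open import Relation.Nullary using (¬_; does; contradiction)
open import Relation.Nullary.Decidable using (dec-true; dec-false)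
open import Relation.Binary.PropositionalEquality using (_≡_; _≢_; refl; sym; trans; cong; module ≡-Reasoning)

start∈vertices : ∀ {c} {x y : Vertex c} (w : Walk x y) → x ∈ vertices w
start∈vertices []           = here refl
start∈vertices (step _ _ _) = here refl

StrictlyIncreasing : ∀ {c} {x y : Vertex c} → Labeling c → Walk x y → Set
StrictlyIncreasing λ' w = Linked _<_ (labels λ' w)

module CubeLabeling {c : ℕ} (λ' : Labeling c)
  (proper : ∀ {e e' x z z'} → Joins e x z → Joins e' x z' → λ' e ≡ λ' e' → z ≡ z')
  (σ : Vertex c → ℕ → Bool)
  (flips : ∀ {e x z} → Joins e x z → ∀ q → σ z q ≡ σ x q xor does (λ' e ≟ q))
  where

  open ≡-Reasoning

  increasing-path⇒strictly : ∀ {x y} (w : Walk x y) → IsPath w → Increasing λ' w → StrictlyIncreasing λ' w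
  increasing-path⇒strictly []                         _             _            = []
  increasing-path⇒strictly (step _ _ [])              _             _            = [-]
  increasing-path⇒strictly (step e j (step e' j' w)) (x∉ ∷ unique) (e≤e' ∷ inc) =
    ≤∧≢⇒< e≤e' (λ e≡e' → All.lookup x∉ (there (start∈vertices w)) (proper (swap j) j' e≡e'))
    ∷ increasing-path⇒strictly (step e' j' w) unique inc

  σ-fixed-off-labels : ∀ {x y q} (w : Walk x y) → All (_≢ q) (labels λ' w) → σ y q ≡ σ x q
  σ-fixed-off-labels []                                  []          = refl
  σ-fixed-off-labels {x} {y} {q} (step {y = z} e j w) (e≢q ∷ off) = begin
    σ y q                      ≡⟨ σ-fixed-off-labels w off ⟩
    σ z q                      ≡⟨ flips j q ⟩
    σ x q xor does (λ' e ≟ q)  ≡⟨ cong (σ x q xor_) (dec-false (λ' e ≟ q) e≢q) ⟩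
    σ x q xor false            ≡⟨ xor-identityʳ (σ x q) ⟩
    σ x q                      ∎

  σ-fixed-below-labels : ∀ {x y q} (w : Walk x y) → All (q <_) (labels λ' w) → σ y q ≡ σ x q
  σ-fixed-below-labels w below = σ-fixed-off-labels w (All.map >⇒≢ below)

  σ-flips-first-label : ∀ {x z y e} (j : Joins e x z) (w : Walk z y) →
                        StrictlyIncreasing λ' (step e j w) → σ y (λ' e) ≡ not (σ x (λ' e))
  σ-flips-first-label {x} {z} {y} {e} j w inc = begin
    σ y a                   ≡⟨ σ-fixed-below-labels w (AllPairs.head (Linked⇒AllPairs <-trans inc)) ⟩
    σ z a                   ≡⟨ flips j a ⟩
    σ x a xor does (a ≟ a)  ≡⟨ cong (σ x a xor_) (dec-true (a ≟ a) refl) ⟩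
    σ x a xor true          ≡⟨ xor-comm (σ x a) true ⟩
    true xor σ x a          ≡⟨ true-xor (σ x a) ⟩
    not (σ x a)             ∎
    where a = λ' e

  first-label-minimal : ∀ {x z₁ z₂ y e₁ e₂} (j₁ : Joins e₁ x z₁) (w₁ : Walk z₁ y) (j₂ : Joins e₂ x z₂) (w₂ : Walk z₂ y) →
                        StrictlyIncreasing λ' (step e₁ j₁ w₁) → StrictlyIncreasing λ' (step e₂ j₂ w₂) → ¬ λ' e₁ < λ' e₂
  first-label-minimal j₁ w₁ j₂ w₂ inc₁ inc₂ e₁<e₂ =
    not-¬ refl (trans (sym (σ-fixed-below-labels (step _ j₂ w₂) (Linked⇒All <-trans e₁<e₂ inc₂)))
                      (σ-flips-first-label j₁ w₁ inc₁))

  no-strictly-increasing-cycle : ∀ {x z e} (j : Joins e x z) (w : Walk z x) → ¬ StrictlyIncreasing λ' (step e j w)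
  no-strictly-increasing-cycle j w inc = not-¬ refl (σ-flips-first-label j w inc)

  strictly-increasing-unique : ∀ {x y} (p q : Walk x y) →
                               StrictlyIncreasing λ' p → StrictlyIncreasing λ' q → vertices p ≡ vertices q
  strictly-increasing-unique []             []             _    _    = refl
  strictly-increasing-unique []             (step _ j w)   _    inc  = contradiction inc (no-strictly-increasing-cycle j w)
  strictly-increasing-unique (step _ j w)   []             inc  _    = contradiction inc (no-strictly-increasing-cycle j w)
  strictly-increasing-unique {x} (step e₁ j₁ w₁) (step e₂ j₂ w₂) inc₁ inc₂
    with proper j₁ j₂ (≤-antisym (≮⇒≥ (first-label-minimal j₂ w₂ j₁ w₁ inc₂ inc₁))
                                 (≮⇒≥ (first-label-minimal j₁ w₁ j₂ w₂ inc₁ inc₂)))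
  ... | refl = cong (x ∷_) (strictly-increasing-unique w₁ w₂ (Linked.tail inc₁) (Linked.tail inc₂))

  good : Good λ'
  good _ _ p q (p-path , q-path , p-inc , q-inc , p≢q) =
    p≢q (strictly-increasing-unique p q (increasing-path⇒strictly p p-path p-inc)
                                        (increasing-path⇒strictly q q-path q-inc))

label : ∀ {c} → Labeling c
label (spoke i)     = toℕ i
label (left _ j _)  = toℕ j
label (right i _ _) = toℕ i

label<c : ∀ {c} (e : Edge c) → label e < c
label<c (spoke i)     = toℕ<n i
label<c (left _ j _)  = toℕ<n j
label<c (right i _ _) = toℕ<n i

label-is-c-labeling : ∀ c → IsKLabeling {c} c label
label-is-c-labeling c = upTo c , ≤-reflexive (length-upTo c) , λ e → ∈-upTo⁺ (label<c e)

data Arc {c : ℕ} : Edge c → Vertex c → Vertex c → Set where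
  spoke⁺ : ∀ i → Arc (spoke i) hub (leaf i)
  spoke⁻ : ∀ i → Arc (spoke i) (leaf i) hub
  left⁺  : ∀ i j p → Arc (left i j p) (leaf i) (mid i j p)
  left⁻  : ∀ i j p → Arc (left i j p) (mid i j p) (leaf i)
  right⁺ : ∀ i j p → Arc (right i j p) (leaf j) (mid i j p)
  right⁻ : ∀ i j p → Arc (right i j p) (mid i j p) (leaf j)

arc : ∀ {c} {e : Edge c} {x y} → Joins e x y → Arc e x y
arc {e = spoke i}     (inj₁ refl) = spoke⁺ i
arc {e = spoke i}     (inj₂ refl) = spoke⁻ i
arc {e = left i j p}  (inj₁ refl) = left⁺ i j p
arc {e = left i j p}  (inj₂ refl) = left⁻ i j p
arc {e = right i j p} (inj₁ refl) = right⁺ i j p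
arc {e = right i j p} (inj₂ refl) = right⁻ i j p

mid-cong : ∀ {c} {i i' j j' : Fin c} {p p'} → i ≡ i' → j ≡ j' → mid i j p ≡ mid i' j' p'
mid-cong {p = p} {p'} refl refl = cong (mid _ _) (<-irrelevant p p')

label-proper : ∀ {c} {e e' : Edge c} {x z z'} → Arc e x z → Arc e' x z' → label e ≡ label e' → z ≡ z'
label-proper (spoke⁺ _)     (spoke⁺ _)      eq = cong leaf (toℕ-injective eq)
label-proper (spoke⁻ _)     (spoke⁻ _)      _  = refl
label-proper (spoke⁻ _)     (left⁺ _ _ p)   eq = contradiction eq (<⇒≢ p)
label-proper (spoke⁻ _)     (right⁺ _ _ p)  eq = contradiction eq (>⇒≢ p)
label-proper (left⁺ _ _ p)  (spoke⁻ _)      eq = contradiction eq (>⇒≢ p)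
label-proper (left⁺ _ _ _)  (left⁺ _ _ _)   eq = mid-cong refl (toℕ-injective eq)
label-proper (left⁺ _ _ p)  (right⁺ _ _ p') eq = contradiction eq (>⇒≢ (<-trans p' p))
label-proper (right⁺ _ _ p) (spoke⁻ _)      eq = contradiction eq (<⇒≢ p)
label-proper (right⁺ _ _ p) (left⁺ _ _ p')  eq = contradiction eq (<⇒≢ (<-trans p p'))
label-proper (right⁺ _ _ _) (right⁺ _ _ _)  eq = mid-cong (toℕ-injective eq) refl
label-proper (left⁻ _ _ _)  (left⁻ _ _ _)   _  = refl
label-proper (left⁻ _ _ p)  (right⁻ _ _ _)  eq = contradiction eq (>⇒≢ p)
label-proper (right⁻ _ _ p) (left⁻ _ _ _)   eq = contradiction eq (<⇒≢ p)
label-proper (right⁻ _ _ _) (right⁻ _ _ _)  _  = refl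

indicator : ∀ {c} → Vertex c → ℕ → Bool
indicator hub         _ = false
indicator (leaf i)    q = does (toℕ i ≟ q)
indicator (mid i j _) q = does (toℕ i ≟ q) xor does (toℕ j ≟ q)

xor-cancelʳ : ∀ a b → (a xor b) xor b ≡ a
xor-cancelʳ a b = begin
  (a xor b) xor b  ≡⟨ xor-assoc a b b ⟩
  a xor (b xor b)  ≡⟨ cong (a xor_) (xor-same b) ⟩
  a xor false      ≡⟨ xor-identityʳ a ⟩
  a                ∎
  where open ≡-Reasoning

xor-cancelˡ : ∀ a b → (a xor b) xor a ≡ b
xor-cancelˡ a b = trans (cong (_xor a) (xor-comm a b)) (xor-cancelʳ b a)

indicator-flips : ∀ {c} {e : Edge c} {x z} → Arc e x z → ∀ q → indicator z q ≡ indicator x q xor does (label e ≟ q)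
indicator-flips (spoke⁺ _)     _ = refl
indicator-flips (spoke⁻ i)     q = sym (xor-same (does (toℕ i ≟ q)))
indicator-flips (left⁺ _ _ _)  _ = refl
indicator-flips (left⁻ i j _)  q = sym (xor-cancelʳ (does (toℕ i ≟ q)) (does (toℕ j ≟ q)))
indicator-flips (right⁺ i j _) q = xor-comm (does (toℕ i ≟ q)) (does (toℕ j ≟ q))
indicator-flips (right⁻ i j _) q = sym (xor-cancelˡ (does (toℕ i ≟ q)) (does (toℕ j ≟ q)))

mainTheorem12 : (c : ℕ) → c ≥ 1 → ∃[ λ' ] (IsKLabeling {c} c λ' × Good λ')
mainTheorem12 c _ = label , label-is-c-labeling c , CubeLabeling.good label
  (λ j j' → label-proper (arc j) (arc j')) indicator (λ j → indicator-flips (arc j))
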